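{- Let $\mathcal{A}$ be a Büchi automaton. Then $\mathcal{L}(\mathrm{SuccRank}(\mathcal{A}))=\mathcal{L}(\mathrm{Schewe}(\mathcal{A}))$.
   Context: Fix a finite nonempty alphabet $\Sigma$; infinite words are $\alpha=\alpha_0\alpha_1\cdots\in\Sigma^\omega$. A Büchi automaton (BA) is $\mathcal{A}=(Q,\delta,I,F)$ with finite state set $Q$, transition function $\delta:Q\times\Sigma\to 2^Q$ (extended to sets by $\delta(P,a)=\bigcup_{p\in P}\delta(p,a)$), initial states $I\subseteq Q$ and accepting states $F\subseteq Q$. A run from $q$ on $\alpha$ is a sequence $\rho_0\rho_1\cdots$ with $\rho_0=q$ and $\rho_{i+1}\in\delta(\rho_i,\alpha_i)$; it is accepting if some state of $F$ occurs in it infinitely often; $\mathcal{L}(\mathcal{A})$ is the set of words with an accepting run from a state of $I$. Let $n=|Q|$. Rankings: a (level) ranking is $f:Q\to\{0,\dots,2n\}$ with $f(q)$ even for every $q\in F$; $\mathrm{rank}(f)=\max_{q\in Q}f(q)$. For $S\subseteq Q$, $f$ is $S$-tight if $\mathrm{rank}(f)$ is odd, $\{f(s):s\in S\}\supseteq\{1,3,\dots,\mathrm{rank}(f)\}$, and $f(q)=0$ for all $q\notin S$. Schewe's construction $\mathrm{Schewe}(\mathcal{A})=(Q_1\cup Q_2,\delta_1\cup\delta_2\cup\delta_3,I',F')$: waiting part $Q_1=2^Q$; tight part $Q_2$ = set of tuples $(S,O,f,i)$ with $S,O\subseteq Q$, $f$ an $S$-tight ranking, $i\in\{0,2,\dots,2n-2\}$,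 $O\subseteq S\cap f^{ -1}(i)$; $I'=\{I\}$; $\delta_1(S,a)=\{\delta(S,a)\}$ and $\delta_2(S,a)=\{(S',\emptyset,f,0): S'=\delta(S,a),\ f\text{ is }S'\text{ -tight}\}$ for $S\in Q_1$; $(S',O',f',i')\in\delta_3((S,O,f,i),a)$ iff $S'=\delta(S,a)$, $f'(q')\le f(q)$ for all $q\in S$, $q'\in\delta(q,a)$, $\mathrm{rank}(f')=\mathrm{rank}(f)$, and either ($O=\emptyset$, $i'=(i+2)\bmod(\mathrm{rank}(f')+1)$, $O'=S'\cap f'^{ -1}(i')$) or ($O\neq\emptyset$, $i'=i$, $O'=\delta(O,a)\cap f'^{ -1}(i)$); $F'=\{\emptyset\}\cup\{(S,\emptyset,f,i)\in Q_2\}$. Runs and acceptance are as for BAs. The predicate SuccRank: let $R_{\mathcal{A}}$ be the deterministic complete graph on $2^Q$ with an edge $R\to\delta(R,a)$ for every $R\subseteq Q$ and $a\in\Sigma$. For $S\subseteq Q$ let $\mathrm{InfReach}(S)\subseteq 2^Q$ be the set of $R\subseteq Q$ such that some infinite path of $R_{\mathcal{A}}$ starting in $S$ visits $R$ infinitely often, and let $\mathrm{MaxInf}(S)=\max\{|R\setminus F|:R\in\mathrm{InfReach}(S)\}$ and $\mathrm{MinInf}(S)=\min\{|R\setminus F|:R\in\mathrm{InfReach}(S)\}$. For a tight macrostate $(S,O,f,i)$ define $\mathrm{Coarse}(S,O,f,i)$ iff $\mathrm{rank}(f)\le 2\,\mathrm{MaxInf}(S)-1$, and $\mathrm{Fine}(S,O,f,i)$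 iff $\mathrm{rank}(f)\le\min\{f(q)+2(\mathrm{MaxInf}(S)-\mathrm{MinInf}(\{q\})):q\in S\}$; $\mathrm{SuccRank}(S,O,f,i)$ iff both hold. $\mathrm{SuccRank}(\mathcal{A})$ denotes $\mathrm{Schewe}(\mathcal{A})$ with the tight-part macrostates restricted to those satisfying the predicate SuccRank (and transitions restricted accordingly). -}

module Defs where

open import Data.Nat using (ℕ; zero; suc; _+_; _*_; _∸_; _≤_; _⊔_; _≡ᵇ_; _%_)
open import Data.Nat.Properties using ()
open import Data.Bool using (Bool; true; false; _∧_)
open import Data.Fin using (Fin)
open import Data.Fin.Subset using (Subset; _∈_; _∉_; _⊆_; _∩_; _─_; ∣_∣; ⊥; ⁅_⁆)
import Data.Empty as Empty
open import Relation.Nullary using (¬_)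
open import Data.Vec using (tabulate; lookup)
open import Data.List using (List; map; foldr; allFin)
open import Data.Bool.ListAction using (any)
open import Data.Product using (Σ; ∃; ∃-syntax; _×_; _,_)
open import Data.Sum using (_⊎_; inj₁; inj₂)
open import Data.Unit using (⊤)
open import Relation.Binary.PropositionalEquality using (_≡_)

Word : ℕ → Set
Word k = ℕ → Fin (suc k)

InfOften : (ℕ → Set) → Set
InfOften P = ∀ i → ∃[ j ] (i ≤ j × P j)

-- General (nondeterministic) Büchi automata given by relations; used to
-- describe both the input automaton's semantics pattern and the
-- macrostate constructions (whose state space is a type of macrostates).

record Aut (Sig : Set) : Set₁ where
  field
    State : Set
    Init  : State → Set
    Trans : State → Sig → State → Set
    Acc   : State → Set

Accepts : ∀ {Sig} → Aut Sig → (ℕ → Sig) → Set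
Accepts A α =
  Σ (ℕ → Aut.State A) λ ρ →
    Aut.Init A (ρ 0) ×
    (∀ i → Aut.Trans A (ρ i) (α i) (ρ (suc i))) ×
    InfOften (λ j → Aut.Acc A (ρ j))

record BA (k : ℕ) : Set where
  field
    n : ℕ
    δ : Fin n → Fin (suc k) → Subset n
    I : Subset n
    F : Subset n

BA-Aut : ∀ {k} → BA k → Aut (Fin (suc k))
BA-Aut A = record
  { State = Fin n
  ; Init  = λ q → q ∈ I
  ; Trans = λ q a q' → q' ∈ δ q a
  ; Acc   = λ q → q ∈ F
  }
  where open BA A

module Constructions {k : ℕ} (A : BA k) where
  open BA A

  post : Subset n → Fin (suc k) → Subset n
  post P a = tabulate (λ q' → any (λ q → lookup P q ∧ lookup (δ q a) q') (allFin n))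

  Ranking : Set
  Ranking = Fin n → ℕ

  rank : Ranking → ℕ
  rank f = foldr _⊔_ 0 (map f (allFin n))

  preimage : Ranking → ℕ → Subset n
  preimage f i = tabulate (λ q → f q ≡ᵇ i)

  Even Odd : ℕ → Set
  Even m = ∃[ h ] (m ≡ h * 2)
  Odd  m = ∃[ h ] (m ≡ suc (h * 2))

  IsRanking : Ranking → Set
  IsRanking f = (∀ q → f q ≤ 2 * n) × (∀ q → q ∈ F → Even (f q))

  Tight : Subset n → Ranking → Set
  Tight S f =
    IsRanking f ×
    Odd (rank f) ×
    (∀ o → Odd o → o ≤ rank f → ∃[ s ] (s ∈ S × f s ≡ o)) ×
    (∀ q → q ∉ S → f q ≡ 0)

  Tuple : Set
  Tuple = Subset n × Subset n × Ranking × ℕ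

  IsQ₂ : Tuple → Set
  IsQ₂ (S , O , f , i) =
    Tight S f × Even i × i + 2 ≤ 2 * n × O ⊆ (S ∩ preimage f i)

  Macro : Set
  Macro = Subset n ⊎ Tuple

  Step₃ : Tuple → Fin (suc k) → Tuple → Set
  Step₃ (S , O , f , i) a (S' , O' , f' , i') =
    S' ≡ post S a ×
    (∀ q q' → q ∈ S → q' ∈ δ q a → f' q' ≤ f q) ×
    rank f' ≡ rank f ×
    ( (O ≡ ⊥ × i' ≡ (i + 2) % suc (rank f') × O' ≡ S' ∩ preimage f' i')
    ⊎ (¬ (O ≡ ⊥) × i' ≡ i × O' ≡ post O a ∩ preimage f' i) )

  -- Schewe(A) with tight-part macrostates restricted to those satisfying Keep
  -- (Keep = everything gives Schewe(A) itself)
  ScheweWith : (Tuple → Set) → Aut (Fin (suc k))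
  ScheweWith Keep = record
    { State = Macro
    ; Init  = init
    ; Trans = trans
    ; Acc   = acc
    }
    where
      init : Macro → Set
      init (inj₁ S) = S ≡ I
      init (inj₂ _) = Empty.⊥

      trans : Macro → Fin (suc k) → Macro → Set
      trans (inj₁ S) a (inj₁ S') = S' ≡ post S a
      trans (inj₁ S) a (inj₂ (S' , O' , f , i)) =
        S' ≡ post S a × O' ≡ ⊥ × i ≡ 0 × Tight S' f ×
        IsQ₂ (S' , O' , f , i) × Keep (S' , O' , f , i)
      trans (inj₂ _) a (inj₁ _) = Empty.⊥
      trans (inj₂ t) a (inj₂ t') =
        (IsQ₂ t × Keep t) × Step₃ t a t' × (IsQ₂ t' × Keep t')

      acc : Macro → Set
      acc (inj₁ S) = S ≡ ⊥
      acc (inj₂ (S , O , f , i)) = O ≡ ⊥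

  Schewe : Aut (Fin (suc k))
  Schewe = ScheweWith (λ _ → ⊤)

  IsPathFrom : Subset n → (ℕ → Subset n) → Set
  IsPathFrom S P = P 0 ≡ S × (∀ j → ∃[ a ] (P (suc j) ≡ post (P j) a))

  InfReach : Subset n → Subset n → Set
  InfReach S R = ∃[ P ] (IsPathFrom S P × InfOften (λ j → P j ≡ R))

  IsMaxInf : Subset n → ℕ → Set
  IsMaxInf S m =
    (∃[ R ] (InfReach S R × ∣ R ─ F ∣ ≡ m)) ×
    (∀ R → InfReach S R → ∣ R ─ F ∣ ≤ m)

  IsMinInf : Subset n → ℕ → Set
  IsMinInf S m =
    (∃[ R ] (InfReach S R × ∣ R ─ F ∣ ≡ m)) ×
    (∀ R → InfReach S R → m ≤ ∣ R ─ F ∣)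

  -- rank(f) ≤ 2 MaxInf(S) − 1   (truncated subtraction agrees here, since
  -- rank(f) is odd for tight f, so both sides are false when MaxInf(S) = 0)
  Coarse : Tuple → Set
  Coarse (S , O , f , i) = ∃[ M ] (IsMaxInf S M × rank f ≤ 2 * M ∸ 1)

  -- rank(f) ≤ f(q) + 2 (MaxInf(S) − MinInf({q})) for all q ∈ S,
  -- written without subtraction: rank(f) + 2 MinInf({q}) ≤ f(q) + 2 MaxInf(S)
  Fine : Tuple → Set
  Fine (S , O , f , i) =
    ∃[ M ] (IsMaxInf S M ×
      (∀ q → q ∈ S → ∃[ m ] (IsMinInf ⁅ q ⁆ m × rank f + 2 * m ≤ f q + 2 * M)))

  SuccRankPred : Tuple → Set
  SuccRankPred t = Coarse t × Fine t

  SuccRank : Aut (Fin (suc k))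
  SuccRank = ScheweWith SuccRankPred

-- SuccRank(A) only deletes tight macrostates, so it suffices that every tight macrostate
-- (S, O, f, i) on a run of Schewe(A) satisfies the predicate; all we use is the infinite
-- δ₃-path leaving it. Along that path the first components S_d trace a path of R_A, and so
-- do the successor sets D_d of {q} for q ∈ S; as there are finitely many subsets, both
-- recur at a common index d, so S_d ∈ InfReach(S) and D_d ∈ InfReach({q}). Tightness puts
-- each odd rank 1, 3, …, rank(f) on a state of S_d, which is not accepting since accepting
-- states have even ranks: this gives Coarse. Ranks never increase along δ, so those odd
-- ranks exceeding f(q) sit outside D_d: this gives Fine. MaxInf and MinInf exist because
-- InfReach is decidable: R ∈ InfReach(S) iff R is reachable from S and lies on a cycle,
-- and reachability only needs words of length at most 2^|Q|.

module Submission where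

open import Defs
open import Data.Bool using (Bool; true; false; T)
import Data.Bool as Bool
open import Data.Bool.Properties using (T-≡; T-∧)
open import Data.Empty using (⊥-elim)
open import Data.Fin using (Fin; zero; suc; toℕ; combine)
open import Data.Fin.Properties using (pigeonhole; toℕ<n; combine-injective; any?)
open import Data.Fin.Subset
  using (Subset; _∈_; _∉_; _⊆_; _⊂_; _─_; _∪_; ∣_∣; ⁅_⁆)
  renaming (⊥ to ∅)
open import Data.Fin.Subset.Properties
  using ( p⊆q⇒∣p∣≤∣q∣; p⊂q⇒∣p∣<∣q∣; ∣p∣≤n; ∉⊥; ⊥⊆; x∈⁅x⁆; x∈⁅y⁆⇒x≡y
        ; p⊆p∪q; x∈p∪q⁺; x∈p∪q⁻; p─q⊆p; x∈p∧x∉q⇒x∈p─q; anySubset? )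
open import Data.List using (allFin)
open import Data.List.Relation.Unary.Any using (satisfied)
open import Data.List.Relation.Unary.Any.Properties using (any⁺; any⁻)
open import Data.List.Membership.Propositional using (lose)
open import Data.List.Membership.Propositional.Properties using (∈-allFin)
open import Data.Nat
open import Data.Nat.Properties
open import Data.Nat.DivMod using (_%_; [m+n]%n≡m%n; m<n⇒m%n≡m)
open import Data.Nat.Induction using (<-rec)
open import Data.Nat.Tactic.RingSolver using (solve-∀)
open import Data.Product using (∃; ∃₂; _×_; _,_; proj₁; proj₂)
import Data.Product as Prod
open import Data.Sum using (_⊎_; inj₁; inj₂)
open import Data.Unit using (⊤; tt)
open import Data.Vec using ([]; _∷_; _++_; lookup; here; there)
open import Data.Vec.Properties
  using (lookup∘tabulate; []=⇒lookup; lookup⇒[]=; ++-injectiveˡ; ++-injectiveʳ; ≡-dec)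
open import Function using (_∘_; const; _⇔_; mk⇔; Equivalence)
open import Relation.Nullary using (Dec; yes; no)
open import Relation.Nullary.Decidable using (map′; _×-dec_)
open import Relation.Unary using (Decidable)
open import Relation.Binary.PropositionalEquality

sideCode : Bool → Fin 2
sideCode false = zero
sideCode true  = suc zero

sideCode-injective : ∀ {b c} → sideCode b ≡ sideCode c → b ≡ c
sideCode-injective {false} {false} _ = refl
sideCode-injective {true}  {true}  _ = refl

subsetCode : ∀ {m} → Subset m → Fin (2 ^ m)
subsetCode []      = zero
subsetCode (b ∷ p) = combine (sideCode b) (subsetCode p)

subsetCode-injective : ∀ {m} (p q : Subset m) → subsetCode p ≡ subsetCode q → p ≡ q
subsetCode-injective []      []      _ = refl
subsetCode-injective (b ∷ p) (c ∷ q) e with combine-injective _ _ _ _ e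
... | b≡c , p≡q = cong₂ _∷_ (sideCode-injective b≡c) (subsetCode-injective p q p≡q)

subset-pigeonhole : ∀ {m} (g : ℕ → Subset m) → ∃₂ λ i j → i < j × j ≤ 2 ^ m × g i ≡ g j
subset-pigeonhole {m} g with i , j , i<j , e ← pigeonhole (n<1+n (2 ^ m)) (subsetCode ∘ g ∘ toℕ) =
  toℕ i , toℕ j , i<j , ≤-pred (toℕ<n j) , subsetCode-injective _ _ e

module _ {P : ℕ → Set} (P? : Decidable P) where

  least : ∃ P → ∃ λ m → P m × ∀ t → P t → m ≤ t
  least (w , pw) = below w (w , ≤-refl , pw)
    where
    below : ∀ b → ∃ (λ t → t ≤ b × P t) → ∃ λ m → P m × ∀ t → P t → m ≤ t
    below b (t , t≤b , pt) with anyUpTo? P? b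
    ... | no ∄ = t , pt , λ t' pt' → ≤-trans t≤b (≮⇒≥ λ t'<b → ∄ (t' , t'<b , pt'))
    below (suc b) _ | yes (t , s≤s t≤b , pt) = below b (t , t≤b , pt)

  greatest : ∀ N → ∃ P → (∀ t → P t → t ≤ N) → ∃ λ M → P M × ∀ t → P t → t ≤ M
  greatest N ex bound with P? N
  ... | yes pN = N , pN , bound
  greatest zero (t , pt) bound | no ¬pN = ⊥-elim (¬pN (subst P (n≤0⇒n≡0 (bound t pt)) pt))
  greatest (suc N) ex bound | no ¬pN =
    greatest N ex λ t pt → ≤-pred (≤∧≢⇒< (bound t pt) λ { refl → ¬pN pt })

x∈p─q⇒x∉q : ∀ {m} (p q : Subset m) {x} → x ∈ p ─ q → x ∉ q
x∈p─q⇒x∉q (true ∷ p) (false ∷ q) here       ()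
x∈p─q⇒x∉q (_ ∷ p)    (_ ∷ q)     (there xi) (there xq) = x∈p─q⇒x∉q p q xi xq

─-monoˡ-⊆ : ∀ {m} {p q : Subset m} (r : Subset m) → p ⊆ q → p ─ r ⊆ q ─ r
─-monoˡ-⊆ {p = p} r p⊆q xi = x∈p∧x∉q⇒x∈p─q (p⊆q (p─q⊆p p r xi)) (x∈p─q⇒x∉q p r xi)

-- The witnesses in X ─ Y of the odd values in (v, 2h) are pairwise distinct.
odd-values⇒∣∣-gap : ∀ {m} (g : Fin m → ℕ) h v {X Y : Subset m} → Y ⊆ X →
  (∀ j → j < h → v < suc (j * 2) → ∃ λ s → s ∈ X × s ∉ Y × g s ≡ suc (j * 2)) →
  h * 2 + 2 * ∣ Y ∣ ≤ suc v + 2 * ∣ X ∣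
odd-values⇒∣∣-gap g zero v Y⊆X _ =
  ≤-trans (*-monoʳ-≤ 2 (p⊆q⇒∣p∣≤∣q∣ Y⊆X)) (m≤n+m _ (suc v))
odd-values⇒∣∣-gap g (suc h) v {X} {Y} Y⊆X odd with v <? suc (h * 2)
... | no v≮ = +-mono-≤ (s≤s (≮⇒≥ v≮)) (*-monoʳ-≤ 2 (p⊆q⇒∣p∣≤∣q∣ Y⊆X))
... | yes v< with s , s∈X , s∉Y , gs ← odd h (n<1+n h) v< = begin
  suc h * 2 + 2 * ∣ Y ∣        ≡⟨ shift h ∣ Y ∣ ⟩
  h * 2 + 2 * suc ∣ Y ∣        ≤⟨ +-monoʳ-≤ (h * 2) (*-monoʳ-≤ 2 (p⊂q⇒∣p∣<∣q∣ Y⊂Y')) ⟩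
  h * 2 + 2 * ∣ Y ∪ ⁅ s ⁆ ∣    ≤⟨ odd-values⇒∣∣-gap g h v Y'⊆X odd' ⟩
  suc v + 2 * ∣ X ∣            ∎
  where
  open ≤-Reasoning
  shift : ∀ a b → suc a * 2 + 2 * b ≡ a * 2 + 2 * suc b
  shift = solve-∀
  Y⊂Y' : Y ⊂ Y ∪ ⁅ s ⁆
  Y⊂Y' = p⊆p∪q ⁅ s ⁆ , s , x∈p∪q⁺ (inj₂ (x∈⁅x⁆ s)) , s∉Y
  Y'⊆X : Y ∪ ⁅ s ⁆ ⊆ X
  Y'⊆X xi with x∈p∪q⁻ Y ⁅ s ⁆ xi
  ... | inj₁ x∈Y = Y⊆X x∈Y
  ... | inj₂ x∈s rewrite x∈⁅y⁆⇒x≡y s x∈s = s∈X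
  odd' : ∀ j → j < h → v < suc (j * 2) → ∃ λ s' → s' ∈ X × s' ∉ Y ∪ ⁅ s ⁆ × g s' ≡ suc (j * 2)
  odd' j j<h v<j with s' , s'∈X , s'∉Y , gs' ← odd j (m<n⇒m<1+n j<h) v<j = s' , s'∈X , s'∉Y' , gs'
    where
    s'∉Y' : s' ∉ Y ∪ ⁅ s ⁆
    s'∉Y' xi with x∈p∪q⁻ Y ⁅ s ⁆ xi
    ... | inj₁ s'∈Y = s'∉Y s'∈Y
    ... | inj₂ s'∈s with refl ← x∈⁅y⁆⇒x≡y s s'∈s =
      <-irrefl (*-cancelʳ-≡ j h 2 (suc-injective (trans (sym gs') gs))) j<h

odd≤double⇒odd≤double∸1 : ∀ h M → suc (h * 2) ≤ 2 * M → suc (h * 2) ≤ 2 * M ∸ 1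
odd≤double⇒odd≤double∸1 h M odd≤ = begin
  suc (h * 2)        ≡⟨ odd≡double-suc∸1 h ⟩
  2 * suc h ∸ 1      ≤⟨ ∸-monoˡ-≤ 1 (*-monoʳ-≤ 2 h<M) ⟩
  2 * M ∸ 1          ∎
  where
  open ≤-Reasoning
  odd≡double-suc∸1 : ∀ a → suc (a * 2) ≡ 2 * suc a ∸ 1
  odd≡double-suc∸1 a = trans (cong suc (*-comm a 2)) (sym (+-suc a (a + 0)))
  h<M : h < M
  h<M = *-cancelˡ-< 2 h M (subst (_< 2 * M) (*-comm h 2) odd≤)

T-lookup⇒∈ : ∀ {m} {p : Subset m} {x} → T (lookup p x) → x ∈ p
T-lookup⇒∈ {p = p} {x} = lookup⇒[]= x p ∘ Equivalence.to T-≡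

∈⇒T-lookup : ∀ {m} {p : Subset m} {x} → x ∈ p → T (lookup p x)
∈⇒T-lookup = Equivalence.from T-≡ ∘ []=⇒lookup

x∈p⇒⁅x⁆⊆p : ∀ {m} {x : Fin m} {p : Subset m} → x ∈ p → ⁅ x ⁆ ⊆ p
x∈p⇒⁅x⁆⊆p {x = x} x∈p y∈⁅x⁆ rewrite x∈⁅y⁆⇒x≡y x y∈⁅x⁆ = x∈p

*2≢suc[*2] : ∀ h j → h * 2 ≢ suc (j * 2)
*2≢suc[*2] h j e = even≢odd h j (trans (*-comm 2 h) (trans e (cong suc (*-comm j 2))))

module _ {k : ℕ} (A : BA k) where
  open BA A
  open Constructions A

  ∈-post⁻ : ∀ {P a x} → x ∈ post P a → ∃ λ p → p ∈ P × x ∈ δ p a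
  ∈-post⁻ {P} {a} {x} x∈
    with p , T[Pp∧δpx] ← satisfied (any⁻ _ (allFin n) (subst T (lookup∘tabulate _ x) (∈⇒T-lookup x∈)))
    with T[Pp] , T[δpx] ← Equivalence.to T-∧ T[Pp∧δpx]
    = p , T-lookup⇒∈ T[Pp] , T-lookup⇒∈ T[δpx]

  ∈-post⁺ : ∀ {P a x p} → p ∈ P → x ∈ δ p a → x ∈ post P a
  ∈-post⁺ {P} {a} {x} {p} p∈P x∈δ = T-lookup⇒∈ (subst T (sym (lookup∘tabulate _ x))
    (any⁺ _ (lose (∈-allFin p) (Equivalence.from T-∧ (∈⇒T-lookup p∈P , ∈⇒T-lookup x∈δ)))))

  post-mono : ∀ {P P'} a → P ⊆ P' → post P a ⊆ post P' a
  post-mono a P⊆P' x∈ with p , p∈P , x∈δ ← ∈-post⁻ x∈ = ∈-post⁺ (P⊆P' p∈P) x∈δ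

  run : Subset n → Word k → ℕ → Subset n
  run S w zero    = S
  run S w (suc t) = post (run S w t) (w t)

  suffix : ℕ → Word k → Word k
  suffix i w t = w (i + t)

  run-+ : ∀ S w i j → run S w (i + j) ≡ run (run S w i) (suffix i w) j
  run-+ S w i zero    = cong (run S w) (+-identityʳ i)
  run-+ S w i (suc j) rewrite +-suc i j = cong (λ R → post R (w (i + j))) (run-+ S w i j)

  run-cong : ∀ S {w w'} j → (∀ t → t < j → w t ≡ w' t) → run S w j ≡ run S w' j
  run-cong S zero    _  = refl
  run-cong S (suc j) w≗w' =
    cong₂ post (run-cong S j λ t t<j → w≗w' t (m<n⇒m<1+n t<j)) (w≗w' j (n<1+n j))

  run-mono : ∀ {P S} w j → P ⊆ S → run P w j ⊆ run S w j
  run-mono w zero    P⊆S = P⊆S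
  run-mono w (suc j) P⊆S = post-mono (w j) (run-mono w j P⊆S)

  splice : ℕ → Word k → Word k → Word k
  splice zero    u w t       = w t
  splice (suc d) u w zero    = u zero
  splice (suc d) u w (suc t) = splice d (suffix 1 u) w t

  splice-< : ∀ d u w t → t < d → splice d u w t ≡ u t
  splice-< (suc d) u w zero    _         = refl
  splice-< (suc d) u w (suc t) (s≤s t<d) = splice-< d (suffix 1 u) w t t<d

  splice-+ : ∀ d u w t → splice d u w (d + t) ≡ w t
  splice-+ zero    u w t = refl
  splice-+ (suc d) u w t = splice-+ d (suffix 1 u) w t

  run-splice : ∀ S d u w j → run S (splice d u w) (d + j) ≡ run (run S u d) w j
  run-splice S d u w j = begin
    run S (splice d u w) (d + j)                          ≡⟨ run-+ S _ d j ⟩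
    run (run S (splice d u w) d) (suffix d (splice d u w)) j
      ≡⟨ cong (λ R → run R _ j) (run-cong S d (splice-< d u w)) ⟩
    run (run S u d) (suffix d (splice d u w)) j           ≡⟨ run-cong _ j (λ t _ → splice-+ d u w t) ⟩
    run (run S u d) w j                                   ∎
    where open ≡-Reasoning

  run-cut : ∀ S w {i₁ i₂} j → run S w i₁ ≡ run S w i₂ →
            run S (splice i₁ w (suffix i₂ w)) (i₁ + j) ≡ run S w (i₂ + j)
  run-cut S w {i₁} {i₂} j e = begin
    run S (splice i₁ w (suffix i₂ w)) (i₁ + j) ≡⟨ run-splice S i₁ w _ j ⟩
    run (run S w i₁) (suffix i₂ w) j           ≡⟨ cong (λ R → run R _ j) e ⟩
    run (run S w i₂) (suffix i₂ w) j           ≡⟨ run-+ S w i₂ j ⟨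
    run S w (i₂ + j)                           ∎
    where open ≡-Reasoning

  cycle : ℕ → Word k → Word k
  cycle p v t = v (t % suc p)

  run-cycle : ∀ {R} p v → run R v (suc p) ≡ R → ∀ m → run R (cycle p v) (m * suc p) ≡ R
  run-cycle p v loop zero = refl
  run-cycle {R} p v loop (suc m) = begin
    run R (cycle p v) (suc p + m * suc p)                ≡⟨ run-+ R _ (suc p) _ ⟩
    run (run R (cycle p v) (suc p)) c⁺ (m * suc p)        ≡⟨ cong (λ X → run X c⁺ (m * suc p)) first-lap ⟩
    run R c⁺ (m * suc p)                                 ≡⟨ run-cong R (m * suc p) (λ t _ → periodic t) ⟩
    run R (cycle p v) (m * suc p)                        ≡⟨ run-cycle p v loop m ⟩
    R                                                    ∎
    where
    open ≡-Reasoning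
    c⁺ : Word k
    c⁺ = suffix (suc p) (cycle p v)
    first-lap : run R (cycle p v) (suc p) ≡ R
    first-lap = trans (run-cong R (suc p) λ t t<p → cong v (m<n⇒m%n≡m t<p)) loop
    periodic : ∀ t → c⁺ t ≡ cycle p v t
    periodic t = cong v (trans (cong (_% suc p) (+-comm (suc p) t)) ([m+n]%n≡m%n t (suc p)))

  lasso⇒InfReach : ∀ {S R} u d v p → run S u d ≡ R → run R v (suc p) ≡ R → InfReach S R
  lasso⇒InfReach {S} {R} u d v p stem loop =
    run S ω , (refl , λ j → ω j , refl) , λ i → d + i * suc p , ≤-trans (m≤m*n i (suc p)) (m≤n+m _ d) , returns i
    where
    ω : Word k
    ω = splice d u (cycle p v)
    returns : ∀ i → run S ω (d + i * suc p) ≡ R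
    returns i = begin
      run S ω (d + i * suc p)                 ≡⟨ run-splice S d u _ _ ⟩
      run (run S u d) (cycle p v) (i * suc p) ≡⟨ cong (λ X → run X (cycle p v) (i * suc p)) stem ⟩
      run R (cycle p v) (i * suc p)           ≡⟨ run-cycle p v loop i ⟩
      R                                       ∎
      where open ≡-Reasoning

  repetition⇒InfReach : ∀ S w {i j} → i < j → run S w i ≡ run S w j → InfReach S (run S w i)
  repetition⇒InfReach S w {i} {j} i<j e = lasso⇒InfReach w i (suffix i w) (j ∸ suc i) refl (begin
    run (run S w i) (suffix i w) (suc (j ∸ suc i)) ≡⟨ run-+ S w i _ ⟨
    run S w (i + suc (j ∸ suc i))                  ≡⟨ cong (run S w) (trans (+-suc i _) (m+[n∸m]≡n i<j)) ⟩
    run S w j                                      ≡⟨ e ⟨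
    run S w i                                      ∎)
    where open ≡-Reasoning

  runs-recur-jointly : ∀ S S' w → ∃ λ d → InfReach S (run S w d) × InfReach S' (run S' w d)
  runs-recur-jointly S S' w with i , j , i<j , _ , e ← subset-pigeonhole (λ d → run S w d ++ run S' w d) =
    i , repetition⇒InfReach S w i<j (++-injectiveˡ _ _ e) , repetition⇒InfReach S' w i<j (++-injectiveʳ _ _ e)

  InfReach-nonempty : ∀ S → ∃ (InfReach S)
  InfReach-nonempty S with d , inf , _ ← runs-recur-jointly S S (const zero) = run S (const zero) d , inf

  Reachable : Subset n → Subset n → Set
  Reachable S R = ∃₂ λ w j → run S w j ≡ R

  OnCycle : Subset n → Set
  OnCycle R = ∃ λ a → Reachable (post R a) R

  InfReach⇔reachable-cycle : ∀ {S R} → InfReach S R ⇔ (Reachable S R × OnCycle R)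
  InfReach⇔reachable-cycle {S} {R} = mk⇔ to from
    where
    from : Reachable S R × OnCycle R → InfReach S R
    from ((u , d , stem) , a , v , p , back) =
      lasso⇒InfReach u d (splice 1 (const a) v) p stem (trans (run-splice R 1 (const a) v p) back)

    to : InfReach S R → Reachable S R × OnCycle R
    to (P , (P₀ , step) , often)
      with j₁ , _ , P[j₁] ← often 0
      with j₂ , j₁<j₂ , P[j₂] ← often (suc j₁) =
      (w , j₁ , trans (run≡P j₁) P[j₁]) , w j₁ , suffix (suc j₁) w , j₂ ∸ suc j₁ , back
      where
      w : Word k
      w t = proj₁ (step t)
      run≡P : ∀ t → run S w t ≡ P t
      run≡P zero    = sym P₀
      run≡P (suc t) = trans (cong (λ X → post X (w t)) (run≡P t)) (sym (proj₂ (step t)))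
      back : run (post R (w j₁)) (suffix (suc j₁) w) (j₂ ∸ suc j₁) ≡ R
      back = begin
        run (post R (w j₁)) (suffix (suc j₁) w) (j₂ ∸ suc j₁)
          ≡⟨ cong (λ X → run (post X (w j₁)) _ (j₂ ∸ suc j₁)) (trans (sym P[j₁]) (sym (run≡P j₁))) ⟩
        run (run S w (suc j₁)) (suffix (suc j₁) w) (j₂ ∸ suc j₁) ≡⟨ run-+ S w (suc j₁) _ ⟨
        run S w (suc j₁ + (j₂ ∸ suc j₁))                         ≡⟨ cong (run S w) (m+[n∸m]≡n j₁<j₂) ⟩
        run S w j₂                                               ≡⟨ trans (run≡P j₂) P[j₂] ⟩
        R                                                        ∎
        where open ≡-Reasoning

  Within : ℕ → Subset n → Subset n → Set
  Within zero    S R = S ≡ R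
  Within (suc i) S R = Within i S R ⊎ ∃ λ a → Within i (post S a) R

  within? : ∀ i S R → Dec (Within i S R)
  within? zero    S R = ≡-dec Bool._≟_ S R
  within? (suc i) S R with within? i S R | any? (λ a → within? i (post S a) R)
  ... | yes w | _     = yes (inj₁ w)
  ... | no ¬w | yes v = yes (inj₂ v)
  ... | no ¬w | no ¬v = no λ { (inj₁ w) → ¬w w ; (inj₂ v) → ¬v v }

  within⇒reachable : ∀ i {S R} → Within i S R → Reachable S R
  within⇒reachable zero    S≡R             = const zero , 0 , S≡R
  within⇒reachable (suc i) (inj₁ w)        = within⇒reachable i w
  within⇒reachable (suc i) {S} (inj₂ (a , w)) with v , j , e ← within⇒reachable i w =
    splice 1 (const a) v , suc j , trans (run-splice S 1 (const a) v j) e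

  within-refl : ∀ i S → Within i S S
  within-refl zero    S = refl
  within-refl (suc i) S = inj₁ (within-refl i S)

  run-within : ∀ {j i} S w → j ≤ i → Within i S (run S w j)
  run-within S w z≤n = within-refl _ S
  run-within {suc j} {suc i} S w (s≤s j≤i) =
    inj₂ (w 0 , subst (Within i (post S (w 0))) (sym (run-+ S w 1 j)) (run-within (post S (w 0)) (suffix 1 w) j≤i))

  -- A run longer than 2 ^ n repeats a set; cutting out the loop shortens it without changing where it ends.
  run-within-2^n : ∀ j S w → Within (2 ^ n) S (run S w j)
  run-within-2^n = <-rec (λ j → ∀ S w → Within (2 ^ n) S (run S w j)) shorten
    where
    shorten : ∀ j → (∀ {j'} → j' < j → ∀ S w → Within (2 ^ n) S (run S w j')) →
              ∀ S w → Within (2 ^ n) S (run S w j)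
    shorten j rec S w with j ≤? 2 ^ n
    ... | yes j≤ = run-within S w j≤
    ... | no j≰ with i₁ , i₂ , i₁<i₂ , i₂≤ , e ← subset-pigeonhole (run S w) =
      subst (Within (2 ^ n) S) cut (rec shorter S (splice i₁ w (suffix i₂ w)))
      where
      i₂≤j : i₂ ≤ j
      i₂≤j = ≤-trans i₂≤ (≤-trans (n≤1+n _) (≰⇒> j≰))
      shorter : i₁ + (j ∸ i₂) < j
      shorter = ≤-trans (+-monoˡ-< (j ∸ i₂) i₁<i₂) (≤-reflexive (m+[n∸m]≡n i₂≤j))
      cut : run S (splice i₁ w (suffix i₂ w)) (i₁ + (j ∸ i₂)) ≡ run S w j
      cut = trans (run-cut S w {i₁} {i₂} (j ∸ i₂) e) (cong (run S w) (m+[n∸m]≡n i₂≤j))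

  reachable⇔within : ∀ {S R} → Reachable S R ⇔ Within (2 ^ n) S R
  reachable⇔within {S} = mk⇔ (λ { (w , j , refl) → run-within-2^n j S w }) (within⇒reachable (2 ^ n))

  infReach? : ∀ S R → Dec (InfReach S R)
  infReach? S R =
    map′ (from InfReach⇔reachable-cycle ∘ Prod.map (from reachable⇔within) (Prod.map₂ (from reachable⇔within)))
         (Prod.map (to reachable⇔within) (Prod.map₂ (to reachable⇔within)) ∘ to InfReach⇔reachable-cycle)
         (within? (2 ^ n) S R ×-dec any? λ a → within? (2 ^ n) (post R a) R)
    where open Equivalence

  InfValue : Subset n → ℕ → Set
  InfValue S t = ∃ λ R → InfReach S R × ∣ R ─ F ∣ ≡ t

  infValue? : ∀ S → Decidable (InfValue S)
  infValue? S t = anySubset? λ R → infReach? S R ×-dec (∣ R ─ F ∣ ≟ t)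

  infValue-nonempty : ∀ S → ∃ (InfValue S)
  infValue-nonempty S with R , inf ← InfReach-nonempty S = _ , R , inf , refl

  maxInf : ∀ S → ∃ (IsMaxInf S)
  maxInf S
    with M , value , max ← greatest (infValue? S) n (infValue-nonempty S) (λ { t (R , _ , refl) → ∣p∣≤n (R ─ F) })
    = M , value , λ R inf → max _ (R , inf , refl)

  minInf : ∀ S → ∃ (IsMinInf S)
  minInf S with m , value , min ← least (infValue? S) (infValue-nonempty S) =
    m , value , λ R inf → min _ (R , inf , refl)

  module TightRun (τ : ℕ → Tuple) (w : Word k)
                  (inQ₂ : ∀ d → IsQ₂ (τ d)) (step : ∀ d → Step₃ (τ d) (w d) (τ (suc d))) where

    S : ℕ → Subset n
    S d = proj₁ (τ d)

    f : ℕ → Ranking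
    f d = proj₁ (proj₂ (proj₂ (τ d)))

    run≡S : ∀ d → run (S 0) w d ≡ S d
    run≡S zero    = refl
    run≡S (suc d) = trans (cong (λ X → post X (w d)) (run≡S d)) (sym (proj₁ (step d)))

    InfReach-S : ∀ d → InfReach (S 0) (run (S 0) w d) → InfReach (S 0) (S d)
    InfReach-S d = subst (InfReach (S 0)) (run≡S d)

    rank-invariant : ∀ d → rank (f d) ≡ rank (f 0)
    rank-invariant zero    = refl
    rank-invariant (suc d) = trans (proj₁ (proj₂ (proj₂ (step d)))) (rank-invariant d)

    rank-odd : ∃ λ h → rank (f 0) ≡ suc (h * 2)
    rank-odd = proj₁ (proj₂ (proj₁ (inQ₂ 0)))

    run⁅q⁆⊆S : ∀ {q} → q ∈ S 0 → ∀ d → run ⁅ q ⁆ w d ⊆ S d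
    run⁅q⁆⊆S q∈ d x∈ = subst (_ ∈_) (run≡S d) (run-mono w d (x∈p⇒⁅x⁆⊆p q∈) x∈)

    rank-nonincreasing : ∀ {q} → q ∈ S 0 → ∀ d {x} → x ∈ run ⁅ q ⁆ w d → f d x ≤ f 0 q
    rank-nonincreasing {q} q∈ zero x∈ rewrite x∈⁅y⁆⇒x≡y q x∈ = ≤-refl
    rank-nonincreasing q∈ (suc d) x∈ with p , p∈ , x∈δ ← ∈-post⁻ x∈ =
      ≤-trans (proj₁ (proj₂ (step d)) p _ (run⁅q⁆⊆S q∈ d p∈) x∈δ) (rank-nonincreasing q∈ d p∈)

    odd-rank-witness : ∀ d j → suc (j * 2) ≤ rank (f 0) → ∃ λ s → s ∈ S d ─ F × f d s ≡ suc (j * 2)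
    odd-rank-witness d j odd≤rank
      with (_ , even-on-F) , _ , witnesses , _ ← proj₁ (inQ₂ d)
      with s , s∈ , fs ← witnesses (suc (j * 2)) (j , refl) (subst (_ ≤_) (sym (rank-invariant d)) odd≤rank)
      = s , x∈p∧x∉q⇒x∈p─q s∈ s∉F , fs
      where
      s∉F : s ∉ F
      s∉F s∈F with h , fs≡ ← even-on-F s s∈F = *2≢suc[*2] h j (trans (sym fs≡) fs)

    -- Every odd rank up to rank (f 0) occurs among the non-accepting states of S d; those above v avoid Y.
    ranks-above : ∀ d v {Y} → Y ⊆ S d ─ F → (∀ {s} → s ∈ Y → f d s ≤ v) →
                  rank (f 0) + 2 * ∣ Y ∣ ≤ v + 2 * ∣ S d ─ F ∣
    ranks-above d v {Y} Y⊆ low with h , rank≡ ← rank-odd =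
      subst (λ r → r + 2 * ∣ Y ∣ ≤ v + 2 * ∣ S d ─ F ∣) (sym rank≡)
        (≤-pred (odd-values⇒∣∣-gap (f d) (suc h) v Y⊆ odd))
      where
      odd : ∀ j → j < suc h → v < suc (j * 2) → ∃ λ s → s ∈ S d ─ F × s ∉ Y × f d s ≡ suc (j * 2)
      odd j (s≤s j≤h) v<
        with s , s∈ , fs ← odd-rank-witness d j (subst (_ ≤_) (sym rank≡) (s≤s (*-monoˡ-≤ 2 j≤h)))
        = s , s∈ , (λ s∈Y → <⇒≱ v< (subst (_≤ v) fs (low s∈Y))) , fs

    coarse : Coarse (τ 0)
    coarse
      with d , inf , _ ← runs-recur-jointly (S 0) (S 0) w
      with M , isMax ← maxInf (S 0)
      with h , rank≡ ← rank-odd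
      = M , isMax , subst (_≤ 2 * M ∸ 1) (sym rank≡)
          (odd≤double⇒odd≤double∸1 h M (subst (_≤ 2 * M) rank≡ rank≤2M))
      where
      open ≤-Reasoning
      rank≤2M : rank (f 0) ≤ 2 * M
      rank≤2M = begin
        rank (f 0)                      ≤⟨ m≤m+n _ _ ⟩
        rank (f 0) + 2 * ∣ ∅ {n} ∣      ≤⟨ ranks-above d 0 ⊥⊆ (λ s∈∅ → ⊥-elim (∉⊥ s∈∅)) ⟩
        2 * ∣ S d ─ F ∣                 ≤⟨ *-monoʳ-≤ 2 (proj₂ isMax _ (InfReach-S d inf)) ⟩
        2 * M                           ∎

    fine : Fine (τ 0)
    fine with M , isMax ← maxInf (S 0) = M , isMax , bound
      where
      bound : ∀ q → q ∈ S 0 → ∃ λ m → IsMinInf ⁅ q ⁆ m × rank (f 0) + 2 * m ≤ f 0 q + 2 * M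
      bound q q∈
        with d , infS , infD ← runs-recur-jointly (S 0) ⁅ q ⁆ w
        with m , isMin ← minInf ⁅ q ⁆
        = m , isMin , (begin
          rank (f 0) + 2 * m                    ≤⟨ +-monoʳ-≤ (rank (f 0)) (*-monoʳ-≤ 2 (proj₂ isMin _ infD)) ⟩
          rank (f 0) + 2 * ∣ run ⁅ q ⁆ w d ─ F ∣ ≤⟨ ranks-above d (f 0 q) (─-monoˡ-⊆ F (run⁅q⁆⊆S q∈ d)) low ⟩
          f 0 q + 2 * ∣ S d ─ F ∣               ≤⟨ +-monoʳ-≤ (f 0 q) (*-monoʳ-≤ 2 (proj₂ isMax _ (InfReach-S d infS))) ⟩
          f 0 q + 2 * M                         ∎)
        where
        open ≤-Reasoning
        low : ∀ {s} → s ∈ run ⁅ q ⁆ w d ─ F → f d s ≤ f 0 q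
        low s∈ = rank-nonincreasing q∈ d (p─q⊆p _ F s∈)

    succRank : SuccRankPred (τ 0)
    succRank = coarse , fine

  KeepAt : (Tuple → Set) → Macro → Set
  KeepAt P (inj₁ _) = ⊤
  KeepAt P (inj₂ t) = P t

  keepAt-everywhere : ∀ {P} → (∀ t → P t) → ∀ x → KeepAt P x
  keepAt-everywhere all (inj₁ _) = tt
  keepAt-everywhere all (inj₂ t) = all t

  module _ {P P' : Tuple → Set} where

    restrict-trans : ∀ x a y → Aut.Trans (ScheweWith P) x a y → KeepAt P' x → KeepAt P' y →
                     Aut.Trans (ScheweWith P') x a y
    restrict-trans (inj₁ _) a (inj₁ _) tr _ _ = tr
    restrict-trans (inj₁ _) a (inj₂ _) (e₁ , e₂ , e₃ , tight , inQ₂ , _) _ keep =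
      e₁ , e₂ , e₃ , tight , inQ₂ , keep
    restrict-trans (inj₂ _) a (inj₂ _) ((inQ₂ , _) , step , (inQ₂' , _)) keep keep' =
      (inQ₂ , keep) , step , (inQ₂' , keep')

    restrict-init : ∀ x → Aut.Init (ScheweWith P) x → Aut.Init (ScheweWith P') x
    restrict-init (inj₁ _) S≡I = S≡I

    restrict-acc : ∀ x → Aut.Acc (ScheweWith P) x → Aut.Acc (ScheweWith P') x
    restrict-acc (inj₁ _) acc = acc
    restrict-acc (inj₂ _) acc = acc

    restrict-accepts : ∀ {α} (acc : Accepts (ScheweWith P) α) → (∀ j → KeepAt P' (proj₁ acc j)) →
                       Accepts (ScheweWith P') α
    restrict-accepts {α} (ρ , init , steps , often) keep =
      ρ , restrict-init (ρ 0) init ,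
      (λ i → restrict-trans (ρ i) (α i) (ρ (suc i)) (steps i) (keep i) (keep (suc i))) ,
      λ i → let j , i≤j , acc = often i in j , i≤j , restrict-acc (ρ j) acc

  tupleOr : Tuple → Macro → Tuple
  tupleOr t (inj₁ _) = t
  tupleOr _ (inj₂ t) = t

  tight-closed : ∀ t₀ {t a} y → Aut.Trans Schewe (inj₂ t) a y → y ≡ inj₂ (tupleOr t₀ y)
  tight-closed t₀ (inj₂ _) _ = refl

  succRank-from-tight-run : ∀ (σ : ℕ → Macro) w t → σ 0 ≡ inj₂ t →
    (∀ d → Aut.Trans Schewe (σ d) (w d) (σ (suc d))) → SuccRankPred t
  succRank-from-tight-run σ w t σ₀ steps =
    subst SuccRankPred (cong (tupleOr t) σ₀)
      (TightRun.succRank τ w (proj₁ ∘ proj₁ ∘ tight-step) (proj₁ ∘ proj₂ ∘ tight-step))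
    where
    τ : ℕ → Tuple
    τ d = tupleOr t (σ d)
    σ≡τ : ∀ d → σ d ≡ inj₂ (τ d)
    σ≡τ zero    = trans σ₀ (cong (inj₂ ∘ tupleOr t) (sym σ₀))
    σ≡τ (suc d) =
      tight-closed t (σ (suc d)) (subst (λ x → Aut.Trans Schewe x (w d) (σ (suc d))) (σ≡τ d) (steps d))
    tight-step : ∀ d → Aut.Trans Schewe (inj₂ (τ d)) (w d) (inj₂ (τ (suc d)))
    tight-step d = subst₂ (λ x y → Aut.Trans Schewe x (w d) y) (σ≡τ d) (σ≡τ (suc d)) (steps d)

  succRank-along-runs : ∀ (α : Word k) (ρ : ℕ → Macro) → (∀ i → Aut.Trans Schewe (ρ i) (α i) (ρ (suc i))) →
                        ∀ j → KeepAt SuccRankPred (ρ j)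
  succRank-along-runs α ρ steps j with ρ j in ρⱼ
  ... | inj₁ _ = tt
  ... | inj₂ t = succRank-from-tight-run (λ d → ρ (j + d)) (λ d → α (j + d)) t
    (trans (cong ρ (+-identityʳ j)) ρⱼ)
    (λ d → subst (λ i → Aut.Trans Schewe (ρ (j + d)) (α (j + d)) (ρ i)) (sym (+-suc j d)) (steps (j + d)))

lemma5 : ∀ {k} (A : BA k) (α : ℕ → Fin (suc k)) →
    Accepts (Constructions.SuccRank A) α ⇔ Accepts (Constructions.Schewe A) α
lemma5 A α = mk⇔
  (λ acc → restrict-accepts A acc λ j → keepAt-everywhere A (λ _ → tt) (proj₁ acc j))
  (λ acc@(ρ , _ , steps , _) → restrict-accepts A acc (succRank-along-runs A α ρ steps))
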